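{- If $n_1, \dots, n_k$ are positive integers with $n_1 \leq n_2 \leq \cdots \leq n_k$, then $B(K_{n_1, \dots, n_k}) = \sum_{i=2}^k n_i$.
   Context: $K_{n_1,\dots,n_k}$ is the complete $k$-partite graph with parts of sizes $n_1,\dots,n_k$. Bodyguards and Presidents is a two-player game on a finite simple graph $G$. One player controls a set of tokens called bodyguards, the other a single token called the president. First all bodyguards are placed on vertices (several may share a vertex), then the president is placed. The players then alternate turns, bodyguards first; on a player's turn, each token they control either moves to an adjacent vertex or stays put. The president is surrounded if every vertex of the open neighbourhood of the president's vertex is occupied by a bodyguard. The bodyguards win if there is a finite time after which, at the end of every bodyguard turn, the president is surrounded; otherwise the president wins. The bodyguard number $B(G)$ is the minimum number of bodyguards that guarantees a win for the bodyguards on $G$ (with $B(G)=0$ for the edgeless graph). -}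

module Defs where

open import Data.Nat using (ℕ; zero; suc; _≤_; _<_)
open import Data.Nat.ListAction using (sum)
open import Data.Fin as Fin using (Fin)
open import Data.List using (List; []; _∷_; tabulate)
open import Data.Product using (Σ; ∃; _×_; _,_; proj₁; proj₂)
open import Data.Sum using (_⊎_)
open import Data.Empty using (⊥)
open import Relation.Nullary using (¬_)
open import Relation.Binary.PropositionalEquality using (_≡_; _≢_)

record Graph : Set₁ where
  field
    V      : Set
    Adj    : V → V → Set
    sym    : ∀ {u v} → Adj u v → Adj v u
    irrefl : ∀ {v} → ¬ Adj v v

module Game (G : Graph) (b : ℕ) where
  open Graph G

  -- positions of the b bodyguards (several may share a vertex)
  Config : Set
  Config = Fin b → V

  BStep : Config → Config → Set
  BStep c c' = ∀ i → c' i ≡ c i ⊎ Adj (c i) (c' i)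

  PStep : V → V → Set
  PStep p p' = p' ≡ p ⊎ Adj p p'

  Surrounded : Config → V → Set
  Surrounded c p = ∀ v → Adj p v → ∃ λ i → c i ≡ v

  -- full history of past states (bodyguard config, president vertex), most recent first
  History : Set
  History = List (Config × V)

  record BStrategy : Set where
    field
      place : Config
      move  : (h : History) (c : Config) (p : V) → Σ Config (BStep c)

  record PStrategy : Set where
    field
      place : Config → V
      -- history (incl. current state), new bodyguard config, own vertex ↦ legal move
      move  : (h : History) (c' : Config) (p : V) → Σ V (PStep p)

  -- state after round t (after the president's move): (past, config, president)
  state : BStrategy → PStrategy → ℕ → History × Config × V
  state σ τ zero = [] , BStrategy.place σ , PStrategy.place τ (BStrategy.place σ)
  state σ τ (suc t) with state σ τ t
  ... | h , c , p =
    let c' = proj₁ (BStrategy.move σ h c p)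
        p' = proj₁ (PStrategy.move τ ((c , p) ∷ h) c' p)
    in ((c , p) ∷ h) , c' , p'

  configAt : History × Config × V → Config
  configAt (_ , c , _) = c

  presAt : History × Config × V → V
  presAt (_ , _ , p) = p

  -- at the end of the (t+1)-th bodyguard turn: bodyguards at config of state (t+1),
  -- president still at its vertex of state t
  SurroundedAfterTurn : BStrategy → PStrategy → ℕ → Set
  SurroundedAfterTurn σ τ t =
    Surrounded (configAt (state σ τ (suc t))) (presAt (state σ τ t))

  Winning : BStrategy → Set
  Winning σ = ∀ τ → ∃ λ T → ∀ t → T ≤ t → SurroundedAfterTurn σ τ t

BodyguardsWin : Graph → ℕ → Set
BodyguardsWin G b = Σ (Game.BStrategy G b) (Game.Winning G b)

BodyguardNumberIs : Graph → ℕ → Set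
BodyguardNumberIs G s = BodyguardsWin G s × (∀ b → b < s → ¬ BodyguardsWin G b)

completeMultipartite : {k : ℕ} → (Fin k → ℕ) → Graph
completeMultipartite {k} ns = record
  { V      = Σ (Fin k) (λ i → Fin (ns i))
  ; Adj    = λ u v → proj₁ u ≢ proj₁ v
  ; sym    = λ ne eq → ne (sym' eq)
  ; irrefl = λ ne → ne refl'
  }
  where
    open import Relation.Binary.PropositionalEquality using () renaming (sym to sym'; refl to refl')

-- n₂ + ⋯ + n_k for ns : Fin (suc m) → ℕ (indices shifted by one)
sumFrom2 : {m : ℕ} → (Fin (suc m) → ℕ) → ℕ
sumFrom2 {m} ns = sum (tabulate {n = m} (λ i → ns (Fin.suc i)))

{-# OPTIONS --safe #-}
-- If the president never leaves a vertex p of the smallest part, the bodyguards must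
-- eventually occupy all n₂ + ⋯ + nₖ neighbours of p at once, so fewer cannot win.
-- Conversely, give one bodyguard a home at each vertex outside the first part.  While the
-- president is in part j, the guards whose home lies in part j stand in the first part
-- instead; since n₁ ≤ nⱼ they cover it, and every other guard is at home.  Switching from
-- the formation for part j to the one for part l moves each guard either not at all or
-- between two different parts, i.e. along an edge, so the bodyguards can always adopt
-- the formation of the president's current part and surround him after every turn.
module Submission where

open import Defs
open import Data.Nat using (ℕ; zero; suc; _≤_; _<_; z≤n; NonZero; >-nonZero)
open import Data.Nat.DivMod using (_%_; _mod_; m<n⇒m%n≡m)
open import Data.Nat.ListAction using (sum)
open import Data.Nat.Properties using (<⇒≱; ≤-refl)
open import Data.Fin as Fin using (Fin; zero; suc; toℕ; inject≤)
open import Data.Fin.Properties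
  using (+↔⊎; injective⇒≤; toℕ-injective; toℕ-fromℕ<; toℕ-inject≤; toℕ<n)
open import Data.List using (tabulate)
open import Data.Product using (Σ; ∃; _,_; proj₁; proj₂)
open import Data.Product.Properties using (≡-dec)
open import Data.Sum using (_⊎_; inj₁; inj₂)
open import Data.Sum.Function.Propositional using (_⊎-↔_)
open import Function using (_∘_)
open import Function.Bundles using (_↔_; mk↔ₛ′; Inverse; Injection)
open import Function.Definitions using (Injective)
open import Function.Properties.Inverse using (↔-refl; ↔-sym; ↔-trans; ↔⇒↣)
open import Relation.Nullary using (¬_; Dec; yes; no; ¬?; contradiction)
open import Relation.Nullary.Decidable using (_⊎-dec_)
open import Relation.Binary.PropositionalEquality
  using (_≡_; _≢_; _≗_; refl; sym; trans; cong; subst)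

Σ-suc↔⊎ : {m : ℕ} {P : Fin (suc m) → Set} → Σ (Fin (suc m)) P ↔ (P zero ⊎ Σ (Fin m) (P ∘ suc))
Σ-suc↔⊎ = mk↔ₛ′
  (λ { (zero , x) → inj₁ x ; (suc a , x) → inj₂ (a , x) })
  (λ { (inj₁ x) → zero , x ; (inj₂ (a , x)) → suc a , x })
  (λ { (inj₁ _) → refl ; (inj₂ _) → refl })
  (λ { (zero , _) → refl ; (suc _ , _) → refl })

sum↔Σ : {m : ℕ} (f : Fin m → ℕ) → Fin (sum (tabulate f)) ↔ Σ (Fin m) (Fin ∘ f)
sum↔Σ {zero}  f = mk↔ₛ′ (λ ()) (λ ()) (λ ()) (λ ())
sum↔Σ {suc m} f = ↔-trans +↔⊎ (↔-trans (↔-refl ⊎-↔ sum↔Σ (f ∘ suc)) (↔-sym Σ-suc↔⊎))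

module _ {n : ℕ} .{{_ : NonZero n}} where

  reduce : {m : ℕ} → Fin m → Fin n
  reduce x = toℕ x mod n

  reduce-inject≤ : {m : ℕ} (y : Fin n) .(n≤m : n ≤ m) → reduce (inject≤ y n≤m) ≡ y
  reduce-inject≤ y n≤m = toℕ-injective (trans (toℕ-fromℕ< _) (trans
    (cong (_% n) (toℕ-inject≤ y n≤m))
    (m<n⇒m%n≡m (toℕ<n y))))

module _ (G : Graph) (b : ℕ) where
  open Graph G using (V; Adj)
  open Game G b

  surrounded⇒≤ : ∀ {c p s} (ι : Fin s → V) → Injective _≡_ _≡_ ι →
                 (∀ k → Adj p (ι k)) → Surrounded c p → s ≤ b
  surrounded⇒≤ {c} {p} ι ι-injective p~ι surrounded = injective⇒≤ guard-injective
    where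
      guard : Fin _ → Fin b
      guard k = proj₁ (surrounded (ι k) (p~ι k))

      guard-stands-on : ∀ k → c (guard k) ≡ ι k
      guard-stands-on k = proj₂ (surrounded (ι k) (p~ι k))

      guard-injective : Injective _≡_ _≡_ guard
      guard-injective {k} {l} eq =
        ι-injective (trans (sym (guard-stands-on k)) (trans (cong c eq) (guard-stands-on l)))

  stayAt : V → PStrategy
  stayAt p = record { place = λ _ → p ; move = λ _ _ q → q , inj₁ refl }

  stayAt-stays : ∀ σ p t → presAt (state σ (stayAt p) t) ≡ p
  stayAt-stays σ p zero    = refl
  stayAt-stays σ p (suc t) = stayAt-stays σ p t

  ¬win-below-degree : ∀ p {s} (ι : Fin s → V) → Injective _≡_ _≡_ ι →
                      (∀ k → Adj p (ι k)) → b < s → ¬ BodyguardsWin G b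
  ¬win-below-degree p ι ι-injective p~ι b<s (σ , winning) =
    <⇒≱ b<s (surrounded⇒≤ ι ι-injective p~ι surrounded)
    where
      T = proj₁ (winning (stayAt p))
      surrounded : Surrounded (configAt (state σ (stayAt p) (suc T))) p
      surrounded = subst (Surrounded _) (stayAt-stays σ p T) (proj₂ (winning (stayAt p)) T ≤-refl)

  -- A strategy must answer every configuration, not only formations, so each guard
  -- heads for its post only when that is a legal step and otherwise stays.
  module _ (step? : ∀ u v → Dec (PStep u v)) where

    towards : (u v : V) → Σ V (PStep u)
    towards u v with step? u v
    ... | yes u→v = v , u→v
    ... | no _    = u , inj₁ refl

    towards-reaches : ∀ {u v} → PStep u v → proj₁ (towards u v) ≡ v
    towards-reaches {u} {v} u→v with step? u v
    ... | yes _   = refl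
    ... | no u↛v = contradiction u→v u↛v

    approach : (c c′ : Config) → Σ Config (BStep c)
    approach c c′ = (λ k → proj₁ (towards (c k) (c′ k))) , (λ k → proj₂ (towards (c k) (c′ k)))

    formation⇒win : {I : Set} (F : I → Config) (i₀ : I) (at : V → I) →
                    (∀ i j → BStep (F i) (F j)) → (∀ p → Surrounded (F (at p)) p) →
                    BodyguardsWin G b
    formation⇒win F i₀ at reform guards = σ , winning
      where
        σ : BStrategy
        σ = record { place = F i₀ ; move = λ _ c p → approach c (F (at p)) }

        reforms : ∀ {c i} → c ≗ F i → ∀ j → proj₁ (approach c (F j)) ≗ F j
        reforms {i = i} c≗Fi j k =
          towards-reaches (subst (λ u → PStep u (F j k)) (sym (c≗Fi k)) (reform i j k))

        in-formation : ∀ τ t → ∃ λ i → configAt (state σ τ t) ≗ F i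
        in-formation τ zero    = i₀ , λ _ → refl
        in-formation τ (suc t) = _ , reforms (proj₂ (in-formation τ t)) _

        winning : Winning σ
        winning τ = 0 , λ t _ v p~v →
          let k , Fk≡v = guards (presAt (state σ τ t)) v p~v
          in k , trans (reforms (proj₂ (in-formation τ t)) _ k) Fk≡v

module _ {m : ℕ} (ns : Fin (suc m) → ℕ) where
  K : Graph
  K = completeMultipartite ns

  open Graph K using (V; Adj)

  Outer : Set
  Outer = Σ (Fin m) (λ a → Fin (ns (suc a)))

  outer : Outer → V
  outer o = suc (proj₁ o) , proj₂ o

  outer-injective : Injective _≡_ _≡_ outer
  outer-injective {_ , _} {_ , _} refl = refl

  home : Fin (sumFrom2 ns) ↔ Outer
  home = sum↔Σ (ns ∘ suc)

  open Inverse home using (to; from; strictlyInverseˡ)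

  step? : ∀ u v → Dec (v ≡ u ⊎ Adj u v)
  step? u v = ≡-dec Fin._≟_ Fin._≟_ v u ⊎-dec ¬? (proj₁ u Fin.≟ proj₁ v)

  ¬win-below : Fin (ns zero) → ∀ b → b < sumFrom2 ns → ¬ BodyguardsWin K b
  ¬win-below y b = ¬win-below-degree K b (zero , y) (outer ∘ to)
    (Injection.injective (↔⇒↣ home) ∘ outer-injective) (λ _ ())

  module _ .{{_ : NonZero (ns zero)}} where

    station : Fin (suc m) → Outer → V
    station j (a , x) with j Fin.≟ suc a
    ... | yes _ = zero , reduce x
    ... | no _  = suc a , x

    station-step : ∀ j l o → station l o ≡ station j o ⊎ Adj (station j o) (station l o)
    station-step j l (a , x) with j Fin.≟ suc a | l Fin.≟ suc a
    ... | yes _ | yes _ = inj₁ refl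
    ... | yes _ | no _  = inj₂ λ ()
    ... | no _  | yes _ = inj₂ λ ()
    ... | no _  | no _  = inj₁ refl

    station-on : ∀ j a x → j ≡ suc a → station j (a , x) ≡ (zero , reduce x)
    station-on j a x j≡a with j Fin.≟ suc a
    ... | yes _   = refl
    ... | no j≢a = contradiction j≡a j≢a

    station-off : ∀ j a x → j ≢ suc a → station j (a , x) ≡ (suc a , x)
    station-off j a x j≢a with j Fin.≟ suc a
    ... | yes j≡a = contradiction j≡a j≢a
    ... | no _    = refl

    station-covers : (∀ a → ns zero ≤ ns (suc a)) →
                     ∀ j v → j ≢ proj₁ v → ∃ λ o → station j o ≡ v
    station-covers smallest zero    (zero , y)  0≢0 = contradiction refl 0≢0
    station-covers smallest (suc a) (zero , y)  _   = (a , inject≤ y (smallest a)) ,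
      trans (station-on (suc a) a _ refl) (cong (zero ,_) (reduce-inject≤ y (smallest a)))
    station-covers smallest j       (suc a , x) j≢a = (a , x) , station-off j a x j≢a

    win : (∀ a → ns zero ≤ ns (suc a)) → BodyguardsWin K (sumFrom2 ns)
    win smallest = formation⇒win K (sumFrom2 ns) step? (λ j → station j ∘ to) zero proj₁
      (λ i j k → station-step i j (to k))
      (λ p v p≁v → let o , station≡v = station-covers smallest (proj₁ p) v p≁v
                   in from o , trans (cong (station (proj₁ p)) (strictlyInverseˡ o)) station≡v)

theorem3p2 : (m : ℕ) (ns : Fin (suc m) → ℕ) →
    (∀ i → 1 ≤ ns i) →
    (∀ i j → i Fin.≤ j → ns i ≤ ns j) →
    BodyguardNumberIs (completeMultipartite ns) (sumFrom2 ns)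
theorem3p2 m ns positive monotone =
  win ns (λ a → monotone zero (suc a) z≤n) , ¬win-below ns (Fin.fromℕ< (positive zero))
  where instance
    n₁-nonZero : NonZero (ns zero)
    n₁-nonZero = >-nonZero (positive zero)
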